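{- Let $m$ and $n$ be positive integers with $m$ odd and $n = \left\lfloor\tfrac{1}{3}\binom{m}{2}\right\rfloor-x$ for some $x \in S$, where $S=\{1,2,3,4\}$ if $m \equiv 1,3 \pmod{6}$ and $S=\{0,1,3\}$ if $m \equiv 5 \pmod{6}$. Then \[Z_{2,2}(m,n) \leqslant \left\lfloor \tfrac{1}{6}m(m-1)+2n \right\rfloor-1.\]
   Context: A hypergraph $H$ consists of a finite vertex set and a multiset of edges, each a nonempty subset of the vertex set. The total degree is the sum of the edge sizes. $H$ is linear if each pair of distinct vertices lies together in at most one edge. $Z_{2,2}(m,n)$ is the maximum total degree of a linear hypergraph with $m$ vertices and $n$ edges. -}

module Defs where

open import Data.Nat using (ℕ; _+_; _*_; _∸_; _≤_)
open import Data.Nat.DivMod using (_/_; _%_)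
open import Data.Nat.Combinatorics using (_C_)
open import Data.Fin using (Fin)
open import Data.Fin.Subset using (Subset; _∈_; ∣_∣; Nonempty)
open import Data.Vec using (Vec; lookup; map; sum)
open import Data.Product using (_×_)
open import Data.Sum using (_⊎_)
open import Relation.Binary.PropositionalEquality using (_≡_; _≢_)
open import Relation.Nullary using (¬_)

-- A hypergraph on vertex set Fin m with n edges; the multiset of edges is
-- represented as a vector of n subsets (order irrelevant, repetition allowed).
record Hypergraph (m n : ℕ) : Set where
  field
    edges    : Vec (Subset m) n
    nonempty : ∀ (i : Fin n) → Nonempty (lookup edges i)

open Hypergraph public

totalDegree : ∀ {m n} → Hypergraph m n → ℕ
totalDegree H = sum (map ∣_∣ (edges H))

-- linear: two distinct vertices lie together in at most one edge
-- (at most one edge of the multiset, i.e. no two distinct edge indices)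
Linear : ∀ {m n} → Hypergraph m n → Set
Linear {m} {n} H =
  ∀ (u v : Fin m) → u ≢ v → ∀ (i j : Fin n) →
    u ∈ lookup (edges H) i → v ∈ lookup (edges H) i →
    u ∈ lookup (edges H) j → v ∈ lookup (edges H) j → i ≡ j

InS : ℕ → ℕ → Set
InS m x =
  ((m % 6 ≡ 1 ⊎ m % 6 ≡ 3) × (x ≡ 1 ⊎ x ≡ 2 ⊎ x ≡ 3 ⊎ x ≡ 4))
  ⊎ (m % 6 ≡ 5 × (x ≡ 0 ⊎ x ≡ 1 ⊎ x ≡ 3))

third-binom : ℕ → ℕ
third-binom m = (m C 2) / 3

bound : ℕ → ℕ → ℕ
bound m n = (m * (m ∸ 1)) / 6 + 2 * n ∸ 1

-- Let k_i be the edge sizes and d(v) the number of vertices sharing no edge with v. By linearity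
-- the edges through v cover ∑_{i ∋ v} (k_i − 1) other vertices, so ∑_i (k_i − 1) k_i + ∑_v d(v)
-- = m(m − 1). As (k − 1) k + 12 = (k − 3)(k − 4) + 6k, a total degree K ≥ ⌊m(m − 1)/6⌋ + 2n
-- forces K = 3n + x and ∑_i (k_i − 3)(k_i − 4) + ∑_v d(v) = m(m − 1) mod 6 ∈ {0, 2}: all edges
-- but at most one have size 3 or 4, and there are x or x ± 2 edges of even size. Since m is odd,
-- d(v) has the parity of the number of even edges through v, so every vertex of an even edge A
-- with d(v) = 0 lies in a second even edge, and A meets at least |A| other even edges. This
-- needs more even edges than are available, for every admissible x.

module Submission where

open import Defs
open import Data.Bool using (Bool; true; false; _∧_; _∨_; not; _xor_)
open import Data.Bool.Properties using (∧-comm; ∧-assoc; ∧-identityʳ; ∧-zeroʳ; ∨-zeroʳ; not-distribˡ-xor; not-injective; not-involutive)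
open import Data.Empty using (⊥)
open import Data.Fin using (Fin; zero; suc)
import Data.Fin.Properties as Fin
open import Data.Fin.Subset using (Subset; _∈_; ∣_∣)
open import Data.Nat using (ℕ; zero; suc; _+_; _*_; _∸_; _≤_; _<_; z≤n; s≤s; s≤s⁻¹)
open import Data.Nat.DivMod using (_%_; _/_; m%n<n; m≡m%n+[m/n]*n; [m+kn]%n≡m%n; m*n/m*o≡n/o)
open import Data.Nat.Combinatorics using (_C_; nC1≡n; nCk+nC[k+1]≡[n+1]C[k+1])
open import Data.Nat.Properties
open import Data.Product using (_×_; _,_; ∃-syntax; proj₁; proj₂)
open import Data.Sum using (_⊎_; inj₁; inj₂)
open import Data.Vec as Vec using (Vec; lookup; []; _∷_)
open import Data.Vec.Properties using (lookup⇒[]=)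
open import Function using (_∘_)
open import Relation.Nullary using (¬_; Dec; yes; no; does; contradiction)
open import Relation.Binary.PropositionalEquality
open import Algebra.Properties.Semiring.Sum +-*-semiring
  using (sum; sum-syntax; sum-cong-≗; ∑-distrib-+; ∑-comm; *-distribˡ-sum)
open import Data.Nat.Tactic.RingSolver using (solve-∀)

∑-const : ∀ n c → ∑[ i < n ] c ≡ n * c
∑-const zero    c = refl
∑-const (suc n) c = cong (c +_) (∑-const n c)

∑-mono-≤ : ∀ {n} {f g : Fin n → ℕ} → (∀ i → f i ≤ g i) → sum f ≤ sum g
∑-mono-≤ {zero}  f≤g = z≤n
∑-mono-≤ {suc n} f≤g = +-mono-≤ (f≤g zero) (∑-mono-≤ (f≤g ∘ suc))

term≤∑ : ∀ {n} (f : Fin n → ℕ) i → f i ≤ sum f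
term≤∑ f zero    = m≤m+n _ _
term≤∑ f (suc i) = ≤-trans (term≤∑ (f ∘ suc) i) (m≤n+m _ _)

∑≡0⇒≡0 : ∀ {n} (f : Fin n → ℕ) → sum f ≡ 0 → ∀ i → f i ≡ 0
∑≡0⇒≡0 f ∑f≡0 i = n≤0⇒n≡0 (subst (f i ≤_) ∑f≡0 (term≤∑ f i))

∑-positive : ∀ {n} (f : Fin n → ℕ) → 0 < sum f → ∃[ i ] 0 < f i
∑-positive {suc n} f 0<∑ with f zero in eq
... | suc _ = zero , subst (0 <_) (sym eq) (s≤s z≤n)
... | zero  with ∑-positive (f ∘ suc) 0<∑
...   | i , 0<fi = suc i , 0<fi

m+n+o≡o+n+m : ∀ m n o → m + n + o ≡ o + n + m
m+n+o≡o+n+m = solve-∀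

m+n+o≡m+o+n : ∀ m n o → m + n + o ≡ m + o + n
m+n+o≡m+o+n = solve-∀

∑-update : ∀ {n} (f g : Fin n → ℕ) j → (∀ i → i ≢ j → f i ≡ g i) →
           sum f + g j ≡ sum g + f j
∑-update {suc n} f g zero    f≗g = begin
  f zero + sum (f ∘ suc) + g zero  ≡⟨ cong (λ s → f zero + s + g zero) (sum-cong-≗ (λ i → f≗g (suc i) λ ())) ⟩
  f zero + sum (g ∘ suc) + g zero  ≡⟨ m+n+o≡o+n+m (f zero) (sum (g ∘ suc)) (g zero) ⟩
  g zero + sum (g ∘ suc) + f zero  ∎
  where open ≡-Reasoning
∑-update {suc n} f g (suc j) f≗g = begin
  f zero + sum (f ∘ suc) + g (suc j)    ≡⟨ +-assoc (f zero) _ _ ⟩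
  f zero + (sum (f ∘ suc) + g (suc j))  ≡⟨ cong₂ _+_ (f≗g zero λ ()) (∑-update (f ∘ suc) (g ∘ suc) j (λ i i≢j → f≗g (suc i) (i≢j ∘ Fin.suc-injective))) ⟩
  g zero + (sum (g ∘ suc) + f (suc j))  ≡⟨ +-assoc (g zero) _ _ ⟨
  g zero + sum (g ∘ suc) + f (suc j)    ∎
  where open ≡-Reasoning

zeroAt : ∀ {n} → (Fin n → ℕ) → Fin n → Fin n → ℕ
zeroAt f j i with i Fin.≟ j
... | yes _ = 0
... | no  _ = f i

zeroAt-≢ : ∀ {n} (f : Fin n → ℕ) {i j} → i ≢ j → zeroAt f j i ≡ f i
zeroAt-≢ f {i} {j} i≢j with i Fin.≟ j
... | yes i≡j = contradiction i≡j i≢j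
... | no  _   = refl

∑-zeroAt : ∀ {n} (f : Fin n → ℕ) j → sum f ≡ sum (zeroAt f j) + f j
∑-zeroAt f j = trans (sym (+-identityʳ _))
  (subst (λ z → sum f + z ≡ sum (zeroAt f j) + f j) deleted
    (∑-update f (zeroAt f j) j (λ i i≢j → sym (zeroAt-≢ f i≢j))))
  where
  deleted : zeroAt f j j ≡ 0
  deleted with j Fin.≟ j
  ... | yes _   = refl
  ... | no  j≢j = contradiction refl j≢j

two-terms≤∑ : ∀ {n} (f : Fin n → ℕ) {i j} → i ≢ j → f i + f j ≤ sum f
two-terms≤∑ f {i} {j} i≢j = begin
  f i + f j                    ≡⟨ cong (_+ f j) (zeroAt-≢ f i≢j) ⟨
  zeroAt f j i + f j         ≤⟨ +-monoˡ-≤ (f j) (term≤∑ (zeroAt f j) i) ⟩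
  sum (zeroAt f j) + f j     ≡⟨ ∑-zeroAt f j ⟨
  sum f                        ∎
  where open ≤-Reasoning

three-terms≤∑ : ∀ {n} (f : Fin n → ℕ) {i j l} → i ≢ j → i ≢ l → j ≢ l →
                f i + f j + f l ≤ sum f
three-terms≤∑ f {i} {j} {l} i≢j i≢l j≢l = begin
  f i + f j + f l                         ≡⟨ cong₂ (λ a b → a + b + f l) (zeroAt-≢ f i≢l) (zeroAt-≢ f j≢l) ⟨
  zeroAt f l i + zeroAt f l j + f l   ≤⟨ +-monoˡ-≤ (f l) (two-terms≤∑ (zeroAt f l) i≢j) ⟩
  sum (zeroAt f l) + f l                ≡⟨ ∑-zeroAt f l ⟨
  sum f                                   ∎
  where open ≤-Reasoning

bit : Bool → ℕ
bit true  = 1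
bit false = 0

count : ∀ n → (Fin n → Bool) → ℕ
count n p = ∑[ i < n ] bit (p i)

infix 4 _≢ᵇ_
_≢ᵇ_ : ∀ {n} → Fin n → Fin n → Bool
i ≢ᵇ j = not (does (i Fin.≟ j))

≢ᵇ-irrefl : ∀ {n} (i : Fin n) → (i ≢ᵇ i) ≡ false
≢ᵇ-irrefl i with i Fin.≟ i
... | yes _   = refl
... | no  i≢i = contradiction refl i≢i

≢⇒≢ᵇ : ∀ {n} {i j : Fin n} → i ≢ j → (i ≢ᵇ j) ≡ true
≢⇒≢ᵇ {i = i} {j} i≢j with i Fin.≟ j
... | yes i≡j = contradiction i≡j i≢j
... | no  _   = refl

≢ᵇ⇒≢ : ∀ {n} {i j : Fin n} → (i ≢ᵇ j) ≡ true → i ≢ j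
≢ᵇ⇒≢ {i = i} {j} i≢ᵇj with i Fin.≟ j
≢ᵇ⇒≢ () | yes _
... | no i≢j = i≢j

∧-true⁻ˡ : ∀ a {b} → a ∧ b ≡ true → a ≡ true
∧-true⁻ˡ true _ = refl

∧-true⁻ʳ : ∀ a {b} → a ∧ b ≡ true → b ≡ true
∧-true⁻ʳ true b≡true = b≡true

count-const : ∀ n b → count n (λ _ → b) ≡ n * bit b
count-const n b = ∑-const n (bit b)

count-remove : ∀ n (p : Fin n → Bool) j → count n (λ i → (i ≢ᵇ j) ∧ p i) + bit (p j) ≡ count n p
count-remove n p j = begin
  count n (λ i → (i ≢ᵇ j) ∧ p i) + bit (p j)  ≡⟨ ∑-update _ (bit ∘ p) j (λ i i≢j → cong (λ b → bit (b ∧ p i)) (≢⇒≢ᵇ i≢j)) ⟩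
  count n p + bit ((j ≢ᵇ j) ∧ p j)            ≡⟨ cong (λ b → count n p + bit (b ∧ p j)) (≢ᵇ-irrefl j) ⟩
  count n p + 0                               ≡⟨ +-identityʳ _ ⟩
  count n p                                   ∎
  where open ≡-Reasoning

count-others : ∀ n (p : Fin n → Bool) {j} → p j ≡ true →
               count n (λ i → (i ≢ᵇ j) ∧ p i) ≡ count n p ∸ 1
count-others n p {j} pj = begin
  count n (λ i → (i ≢ᵇ j) ∧ p i)                  ≡⟨ m+n∸n≡m _ 1 ⟨
  count n (λ i → (i ≢ᵇ j) ∧ p i) + 1 ∸ 1          ≡⟨ cong (λ b → count n (λ i → (i ≢ᵇ j) ∧ p i) + bit b ∸ 1) pj ⟨
  count n (λ i → (i ≢ᵇ j) ∧ p i) + bit (p j) ∸ 1  ≡⟨ cong (_∸ 1) (count-remove n p j) ⟩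
  count n p ∸ 1                                   ∎
  where open ≡-Reasoning

count-cong : ∀ n {p q : Fin n → Bool} → (∀ i → p i ≡ q i) → count n p ≡ count n q
count-cong n p≗q = sum-cong-≗ (cong bit ∘ p≗q)

count-positive : ∀ n (p : Fin n → Bool) {i} → p i ≡ true → 0 < count n p
count-positive n p {i} pi = subst (λ b → bit b ≤ count n p) pi (term≤∑ (bit ∘ p) i)

count-witness : ∀ n (p : Fin n → Bool) → 0 < count n p → ∃[ i ] p i ≡ true
count-witness n p 0<count with ∑-positive (bit ∘ p) 0<count
... | i , 0<bit with p i in pi
...   | true = i , pi

count-remove₂ : ∀ n (p : Fin n → Bool) {v w} → (w ≢ᵇ v) ≡ true →
  count n (λ i → (i ≢ᵇ w) ∧ ((i ≢ᵇ v) ∧ p i)) + bit (p w) + bit (p v) ≡ count n p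
count-remove₂ n p {v} {w} w≢ᵇv = begin
  count n (λ i → (i ≢ᵇ w) ∧ ((i ≢ᵇ v) ∧ p i)) + bit (p w) + bit (p v)
    ≡⟨ cong (λ b → count n (λ i → (i ≢ᵇ w) ∧ ((i ≢ᵇ v) ∧ p i)) + bit (b ∧ p w) + bit (p v)) w≢ᵇv ⟨
  count n (λ i → (i ≢ᵇ w) ∧ ((i ≢ᵇ v) ∧ p i)) + bit ((w ≢ᵇ v) ∧ p w) + bit (p v)
    ≡⟨ cong (_+ bit (p v)) (count-remove n (λ i → (i ≢ᵇ v) ∧ p i) w) ⟩
  count n (λ i → (i ≢ᵇ v) ∧ p i) + bit (p v)
    ≡⟨ count-remove n p v ⟩
  count n p ∎
  where open ≡-Reasoning

bit+bit≤1 : ∀ a b → (a ≡ true → b ≡ true → ⊥) → bit a + bit b ≤ 1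
bit+bit≤1 false false _        = z≤n
bit+bit≤1 false true  _        = ≤-refl
bit+bit≤1 true  false _        = ≤-refl
bit+bit≤1 true  true  disjoint = contradiction refl (disjoint refl)

bit-⇒ : ∀ a b → (a ≡ true → b ≡ true) → bit b ≡ bit a + bit (b ∧ not a)
bit-⇒ true  true  _   = refl
bit-⇒ true  false a⇒b = contradiction (a⇒b refl) λ ()
bit-⇒ false b     _   = cong bit (sym (∧-identityʳ b))

count-split : ∀ n {p q : Fin n → Bool} → (∀ i → p i ≡ true → q i ≡ true) →
              count n q ≡ count n p + count n (λ i → q i ∧ not (p i))
count-split n {p} {q} p⇒q =
  trans (sum-cong-≗ (λ i → bit-⇒ (p i) (q i) (p⇒q i))) (∑-distrib-+ (bit ∘ p) (λ i → bit (q i ∧ not (p i))))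

count-mono : ∀ n {p q : Fin n → Bool} → (∀ i → p i ≡ true → q i ≡ true) → count n p ≤ count n q
count-mono n {p} p⇒q = subst (count n p ≤_) (sym (count-split n p⇒q)) (m≤m+n _ _)

count-≡⇒⊇ : ∀ n {p q : Fin n → Bool} → (∀ i → p i ≡ true → q i ≡ true) →
            count n p ≡ count n q → ∀ i → q i ≡ true → p i ≡ true
count-≡⇒⊇ n {p} {q} p⇒q same i qi with p i in pi
... | true  = refl
... | false = contradiction (∑≡0⇒≡0 _ nothing-else i) (subst₂ (λ a b → bit (a ∧ not b) ≢ 0) (sym qi) (sym pi) λ ())
  where
  nothing-else : count n (λ i → q i ∧ not (p i)) ≡ 0
  nothing-else = +-cancelˡ-≡ (count n p) _ _ (trans (sym (count-split n p⇒q)) (trans (sym same) (sym (+-identityʳ _))))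

any : ∀ n → (Fin n → Bool) → Bool
any zero    p = false
any (suc n) p = p zero ∨ any n (p ∘ suc)

any-witness : ∀ n (p : Fin n → Bool) → any n p ≡ true → ∃[ i ] p i ≡ true
any-witness (suc n) p any≡true with p zero in p0
... | true  = zero , p0
... | false with any-witness n (p ∘ suc) any≡true
...   | i , pi = suc i , pi

any-intro : ∀ n (p : Fin n → Bool) {i} → p i ≡ true → any n p ≡ true
any-intro (suc n) p {zero}  p0 rewrite p0 = refl
any-intro (suc n) p {suc i} pi rewrite any-intro n (p ∘ suc) pi = ∨-zeroʳ (p zero)

bit-∨-disjoint : ∀ a c r → (a ∧ c ∧ r ≢ true) → bit (a ∧ (c ∨ r)) ≡ bit (a ∧ c) + bit (a ∧ r)
bit-∨-disjoint false c     r     _        = refl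
bit-∨-disjoint true  true  true  disjoint = contradiction refl disjoint
bit-∨-disjoint true  true  false _        = refl
bit-∨-disjoint true  false r     _        = refl

bit*count : ∀ n b (p : Fin n → Bool) → bit b * count n p ≡ count n (λ i → p i ∧ b)
bit*count n true  p = trans (*-identityˡ _) (count-cong n (λ i → sym (∧-identityʳ (p i))))
bit*count n false p = sym (trans (count-cong n (λ i → ∧-zeroʳ (p i))) (trans (count-const n false) (*-zeroʳ n)))

-- The hypothesis makes the sets {x | P x ∧ R x y}, for the y related to x₀, pairwise disjoint.
∑-count-linear : ∀ a b (P : Fin a → Bool) (R : Fin a → Fin b → Bool) (x₀ : Fin a) →
  (∀ x → P x ≡ true → ∀ y y′ → R x₀ y ≡ true → R x y ≡ true → R x₀ y′ ≡ true → R x y′ ≡ true → y ≡ y′) →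
  ∑[ y < b ] (bit (R x₀ y) * count a (λ x → P x ∧ R x y))
    ≡ count a (λ x → P x ∧ any b (λ y → R x₀ y ∧ R x y))
∑-count-linear a zero    P R x₀ linear =
  sym (trans (count-cong a (λ x → ∧-zeroʳ (P x))) (trans (count-const a false) (*-zeroʳ a)))
∑-count-linear a (suc b) P R x₀ linear = begin
  bit (R x₀ zero) * count a (λ x → P x ∧ R x zero) + ∑[ y < b ] (bit (R x₀ (suc y)) * count a (λ x → P x ∧ R x (suc y)))
    ≡⟨ cong₂ _+_ first rest ⟩
  count a (λ x → P x ∧ here x) + count a (λ x → P x ∧ later x)
    ≡⟨ ∑-distrib-+ (λ x → bit (P x ∧ here x)) (λ x → bit (P x ∧ later x)) ⟨
  ∑[ x < a ] (bit (P x ∧ here x) + bit (P x ∧ later x))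
    ≡⟨ sum-cong-≗ (λ x → bit-∨-disjoint (P x) (here x) (later x) (disjoint x)) ⟨
  count a (λ x → P x ∧ (here x ∨ later x))
    ∎
  where
  open ≡-Reasoning
  here later : Fin a → Bool
  here  x = R x₀ zero ∧ R x zero
  later x = any b (λ y → R x₀ (suc y) ∧ R x (suc y))

  first : bit (R x₀ zero) * count a (λ x → P x ∧ R x zero) ≡ count a (λ x → P x ∧ here x)
  first = trans (bit*count a (R x₀ zero) (λ x → P x ∧ R x zero))
                (count-cong a λ x → trans (∧-assoc (P x) _ _) (cong (P x ∧_) (∧-comm (R x zero) _)))

  rest : ∑[ y < b ] (bit (R x₀ (suc y)) * count a (λ x → P x ∧ R x (suc y)))
         ≡ count a (λ x → P x ∧ later x)
  rest = ∑-count-linear a b P (λ x y → R x (suc y)) x₀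
           (λ x Px y y′ r₀ r r₀′ r′ → Fin.suc-injective (linear x Px (suc y) (suc y′) r₀ r r₀′ r′))

  disjoint : ∀ x → P x ∧ here x ∧ later x ≢ true
  disjoint x both with any-witness b _ (∧-true⁻ʳ (here x) (∧-true⁻ʳ (P x) both))
  ... | y , r₀′∧r′ with linear x (∧-true⁻ˡ (P x) both) zero (suc y)
         (∧-true⁻ˡ (R x₀ zero) (∧-true⁻ˡ (here x) (∧-true⁻ʳ (P x) both)))
         (∧-true⁻ʳ (R x₀ zero) (∧-true⁻ˡ (here x) (∧-true⁻ʳ (P x) both)))
         (∧-true⁻ˡ (R x₀ (suc y)) r₀′∧r′) (∧-true⁻ʳ (R x₀ (suc y)) r₀′∧r′)
  ... | ()

bit*others : ∀ n (p : Fin n → Bool) j b → (b ≡ true → p j ≡ true) →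
             bit b * count n (λ i → (i ≢ᵇ j) ∧ p i) ≡ bit b * (count n p ∸ 1)
bit*others n p j true  b⇒pj = cong (1 *_) (count-others n p (b⇒pj refl))
bit*others n p j false _    = refl

odd : ℕ → Bool
odd zero    = false
odd (suc n) = not (odd n)

odd-+ : ∀ a b → odd (a + b) ≡ odd a xor odd b
odd-+ zero    b = refl
odd-+ (suc a) b = trans (cong not (odd-+ a b)) (not-distribˡ-xor (odd a) (odd b))

odd-∑ : ∀ {n} (f : Fin n → ℕ) → (∀ i → odd (f i) ≡ false) → odd (sum f) ≡ false
odd-∑ {zero}  f even = refl
odd-∑ {suc n} f even = trans (odd-+ (f zero) _) (cong₂ _xor_ (even zero) (odd-∑ (f ∘ suc) (even ∘ suc)))

xor≡false⇒≡ : ∀ {a b} → a xor b ≡ false → a ≡ b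
xor≡false⇒≡ {true}  {true}  _ = refl
xor≡false⇒≡ {false} {false} _ = refl

even-sum⇒same-parity : ∀ a b → odd (a + b) ≡ false → odd a ≡ odd b
even-sum⇒same-parity a b even = xor≡false⇒≡ (trans (sym (odd-+ a b)) even)

%2≡1⇒odd : ∀ n → n % 2 ≡ 1 → odd n ≡ true
%2≡1⇒odd (suc zero)    _ = refl
%2≡1⇒odd (suc (suc n)) n%2≡1 = trans (not-involutive (odd n)) (%2≡1⇒odd n n%2≡1)

even⇒2≤ : ∀ k → odd k ≡ false → 0 < k → 2 ≤ k
even⇒2≤ (suc (suc k)) _ _ = s≤s (s≤s z≤n)

even⇒4≤ : ∀ k → odd k ≡ false → 2 < k → 4 ≤ k
even⇒4≤ 2                         _ (s≤s (s≤s ()))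
even⇒4≤ (suc (suc (suc (suc k)))) _ _ = s≤s (s≤s (s≤s (s≤s z≤n)))

∣∣≡count : ∀ {m} (p : Subset m) → ∣ p ∣ ≡ count m (lookup p)
∣∣≡count []          = refl
∣∣≡count (true  ∷ p) = cong suc (∣∣≡count p)
∣∣≡count (false ∷ p) = ∣∣≡count p

sum-map≡∑-lookup : ∀ {A : Set} {n} (f : A → ℕ) (xs : Vec A n) → Vec.sum (Vec.map f xs) ≡ ∑[ i < n ] f (lookup xs i)
sum-map≡∑-lookup f []       = refl
sum-map≡∑-lookup f (x ∷ xs) = cong (f x +_) (sum-map≡∑-lookup f xs)

m*[m∸1]+m≡m*m : ∀ m → m * (m ∸ 1) + m ≡ m * m
m*[m∸1]+m≡m*m zero    = refl
m*[m∸1]+m≡m*m (suc m) = trans (+-comm (suc m * m) (suc m)) (sym (*-suc (suc m) m))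

odd-[k∸1]+even : ∀ k → 0 < k → odd (k ∸ 1 + bit (not (odd k))) ≡ false
odd-[k∸1]+even (suc k) _ with odd k in odd-k
... | true  = trans (odd-+ k 1) (cong (_xor true) odd-k)
... | false = trans (odd-+ k 0) (cong (_xor false) odd-k)

-- defect k = (k − 3)(k − 4) for k ≥ 1; the value at 0 keeps defect-identity true there.
defect : ℕ → ℕ
defect 0 = 12
defect 1 = 6
defect 2 = 2
defect 3 = 0
defect 4 = 0
defect 5 = 2
defect (suc (suc (suc (suc (suc (suc k)))))) = 6 + k * (k + 5)

defect-identity : ∀ k → (k ∸ 1) * k + 12 ≡ defect k + 6 * k
defect-identity 0 = refl
defect-identity 1 = refl
defect-identity 2 = refl
defect-identity 3 = refl
defect-identity 4 = refl
defect-identity 5 = refl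
defect-identity (suc (suc (suc (suc (suc (suc k)))))) = expand k
  where
  expand : ∀ k → (5 + k) * (6 + k) + 12 ≡ 6 + k * (k + 5) + 6 * (6 + k)
  expand = solve-∀

defect≡0⇒≡3+bit : ∀ k → defect k ≡ 0 → k ≡ 3 + bit (not (odd k))
defect≡0⇒≡3+bit 3 _ = refl
defect≡0⇒≡3+bit 4 _ = refl
defect≡0⇒≡3+bit 0 ()
defect≡0⇒≡3+bit 1 ()
defect≡0⇒≡3+bit 2 ()
defect≡0⇒≡3+bit 5 ()
defect≡0⇒≡3+bit (suc (suc (suc (suc (suc (suc k)))))) ()

defect∈[1,2]⇒ : ∀ k → 0 < defect k → defect k ≤ 2 → defect k ≡ 2 × (k ≡ 2 ⊎ k ≡ 5)
defect∈[1,2]⇒ 2 _ _ = refl , inj₁ refl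
defect∈[1,2]⇒ 5 _ _ = refl , inj₂ refl
defect∈[1,2]⇒ 0 _ (s≤s (s≤s ()))
defect∈[1,2]⇒ 1 _ (s≤s (s≤s ()))
defect∈[1,2]⇒ (suc (suc (suc (suc (suc (suc k)))))) _ (s≤s (s≤s ()))

∑-defect : ∀ {n} (k : Fin n → ℕ) →
  ∑[ i < n ] ((k i ∸ 1) * k i) + 12 * n ≡ ∑[ i < n ] defect (k i) + 6 * sum k
∑-defect {n} k = begin
  ∑[ i < n ] ((k i ∸ 1) * k i) + 12 * n
    ≡⟨ cong (∑[ i < n ] ((k i ∸ 1) * k i) +_) (trans (*-comm 12 n) (sym (∑-const n 12))) ⟩
  ∑[ i < n ] ((k i ∸ 1) * k i) + ∑[ i < n ] 12
    ≡⟨ ∑-distrib-+ (λ i → (k i ∸ 1) * k i) (λ _ → 12) ⟨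
  ∑[ i < n ] ((k i ∸ 1) * k i + 12)
    ≡⟨ sum-cong-≗ (defect-identity ∘ k) ⟩
  ∑[ i < n ] (defect (k i) + 6 * k i)
    ≡⟨ ∑-distrib-+ (defect ∘ k) (λ i → 6 * k i) ⟩
  ∑[ i < n ] defect (k i) + ∑[ i < n ] (6 * k i)
    ≡⟨ cong (∑[ i < n ] defect (k i) +_) (*-distribˡ-sum 6 k) ⟨
  ∑[ i < n ] defect (k i) + 6 * sum k ∎
  where open ≡-Reasoning

-- The two counts give 6 (K − q − 2N) + G + D = ρ < 6, which forces K = q + 2N.
squeeze : ∀ {T D G K q N ρ} → ρ < 6 → T + D ≡ ρ + 6 * q → T + 12 * N ≡ G + 6 * K → q + 2 * N ≤ K →
          K ≡ q + 2 * N × G + D ≡ ρ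
squeeze {T} {D} {G} {K} {q} {N} {ρ} ρ<6 T+D≡ T+12N≡ q+2N≤K
  with m≤n⇒∃[o]m+o≡n q+2N≤K
... | e , q+2N+e≡K = trans (sym q+2N+e≡K) (trans (cong (q + 2 * N +_) e≡0) (+-identityʳ _))
                   , trans (sym (+-identityʳ (G + D))) (trans (cong (λ z → G + D + 6 * z) (sym e≡0)) G+D+6e≡ρ)
  where
  open ≡-Reasoning
  G+D+6e≡ρ : G + D + 6 * e ≡ ρ
  G+D+6e≡ρ = +-cancelʳ-≡ (6 * (q + 2 * N)) _ _ (begin
    G + D + 6 * e + 6 * (q + 2 * N)  ≡⟨ regroup G D e (q + 2 * N) ⟩
    G + 6 * (q + 2 * N + e) + D      ≡⟨ cong (λ z → G + 6 * z + D) q+2N+e≡K ⟩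
    G + 6 * K + D                    ≡⟨ cong (_+ D) T+12N≡ ⟨
    T + 12 * N + D                   ≡⟨ m+n+o≡m+o+n T (12 * N) D ⟩
    T + D + 12 * N                   ≡⟨ cong (_+ 12 * N) T+D≡ ⟩
    ρ + 6 * q + 12 * N               ≡⟨ regroup′ ρ q N ⟩
    ρ + 6 * (q + 2 * N)              ∎)
    where
    regroup : ∀ G D e s → G + D + 6 * e + 6 * s ≡ G + 6 * (s + e) + D
    regroup = solve-∀
    regroup′ : ∀ ρ q N → ρ + 6 * q + 12 * N ≡ ρ + 6 * (q + 2 * N)
    regroup′ = solve-∀
  e≡0 : e ≡ 0
  e≡0 = n<1⇒n≡0 (*-cancelˡ-< 6 e 1 (≤-<-trans (m≤n+m (6 * e) (G + D)) (subst (_< 6) (sym G+D+6e≡ρ) ρ<6)))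

m*[m∸1]%6 : ∀ m r → m % 6 ≡ suc r → m * (m ∸ 1) % 6 ≡ suc r * r % 6
m*[m∸1]%6 m r m%6≡1+r = begin
  m * (m ∸ 1) % 6
    ≡⟨ cong (λ z → z * (z ∸ 1) % 6) (trans (m≡m%n+[m/n]*n m 6) (cong (_+ m / 6 * 6) m%6≡1+r)) ⟩
  (suc r + m / 6 * 6) * (r + m / 6 * 6) % 6
    ≡⟨ cong (_% 6) (expand r (m / 6)) ⟩
  (suc r * r + m / 6 * (1 + 2 * r + 6 * (m / 6)) * 6) % 6
    ≡⟨ [m+kn]%n≡m%n (suc r * r) (m / 6 * (1 + 2 * r + 6 * (m / 6))) 6 ⟩
  suc r * r % 6 ∎
  where
  open ≡-Reasoning
  expand : ∀ r j → (suc r + j * 6) * (r + j * 6) ≡ suc r * r + j * (1 + 2 * r + 6 * j) * 6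
  expand = solve-∀

2*nC2 : ∀ m → 2 * (m C 2) ≡ m * (m ∸ 1)
2*nC2 zero    = refl
2*nC2 (suc m) = begin
  2 * (suc m C 2)        ≡⟨ cong (2 *_) (nCk+nC[k+1]≡[n+1]C[k+1] m 1) ⟨
  2 * (m C 1 + m C 2)    ≡⟨ cong (λ c → 2 * (c + m C 2)) (nC1≡n m) ⟩
  2 * (m + m C 2)        ≡⟨ *-distribˡ-+ 2 m (m C 2) ⟩
  2 * m + 2 * (m C 2)    ≡⟨ cong (2 * m +_) (2*nC2 m) ⟩
  2 * m + m * (m ∸ 1)    ≡⟨ 2*m+m*[m∸1]≡[1+m]*m m ⟩
  suc m * m              ∎
  where
  open ≡-Reasoning
  2*m+m*[m∸1]≡[1+m]*m : ∀ m → 2 * m + m * (m ∸ 1) ≡ suc m * m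
  2*m+m*[m∸1]≡[1+m]*m zero    = refl
  2*m+m*[m∸1]≡[1+m]*m (suc m) = expand m
    where
    expand : ∀ m → 2 * suc m + suc m * m ≡ suc (suc m) * suc m
    expand = solve-∀

third-binom≡ : ∀ m → third-binom m ≡ m * (m ∸ 1) / 6
third-binom≡ m = trans (sym (m*n/m*o≡n/o 2 (m C 2) 3)) (cong (_/ 6) (2*nC2 m))

0<k≡m∸n⇒m≡k+n : ∀ {k m n} → 0 < k → k ≡ m ∸ n → m ≡ k + n
0<k≡m∸n⇒m≡k+n {k} {m} {n} 0<k k≡m∸n =
  trans (sym (m∸n+n≡m {m} {n} (<⇒≤ (m∸n≢0⇒n<m (subst (_≢ 0) k≡m∸n (n>0⇒n≢0 0<k)))))) (cong (_+ n) (sym k≡m∸n))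

m+n+2*m≡m*3+n : ∀ m n → m + n + 2 * m ≡ m * 3 + n
m+n+2*m≡m*3+n = solve-∀

≰⇒≤∸1 : ∀ {m n} → ¬ (n ≤ m) → m ≤ n ∸ 1
≰⇒≤∸1 {m} {n} n≰m = subst (m ≤_) (pred[m∸n]≡m∸[1+n] n 0) (suc[m]≤n⇒m≤pred[n] (≰⇒> n≰m))

module LinearHypergraph {m n : ℕ} (H : Hypergraph m n) (linear : Linear H) where

  incident : Fin m → Fin n → Bool
  incident v i = lookup (lookup (edges H) i) v

  size : Fin n → ℕ
  size i = count m (λ v → incident v i)

  totalDegree≡∑size : totalDegree H ≡ ∑[ i < n ] size i
  totalDegree≡∑size = trans (sum-map≡∑-lookup ∣_∣ (edges H)) (sum-cong-≗ (∣∣≡count ∘ lookup (edges H)))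

  incident⇒size>0 : ∀ {v i} → incident v i ≡ true → 0 < size i
  incident⇒size>0 = count-positive m _

  incident⇒∈ : ∀ {v i} → incident v i ≡ true → v ∈ lookup (edges H) i
  incident⇒∈ {v} = lookup⇒[]= v _

  one-edge-through-two-vertices : ∀ {u v i j} → u ≢ v →
    incident u i ≡ true → incident v i ≡ true → incident u j ≡ true → incident v j ≡ true → i ≡ j
  one-edge-through-two-vertices u≢v ui vi uj vj =
    linear _ _ u≢v _ _ (incident⇒∈ ui) (incident⇒∈ vi) (incident⇒∈ uj) (incident⇒∈ vj)

  one-vertex-in-two-edges : ∀ {u v i j} → i ≢ j →
    incident u i ≡ true → incident u j ≡ true → incident v i ≡ true → incident v j ≡ true → u ≡ v
  one-vertex-in-two-edges {u} {v} i≢j ui uj vi vj with u Fin.≟ v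
  ... | yes u≡v = u≡v
  ... | no  u≢v = contradiction (one-edge-through-two-vertices u≢v ui vi uj vj) i≢j

  adjacent : Fin m → Fin m → Bool
  adjacent v w = any n (λ i → incident v i ∧ incident w i)

  adjacent-sym : ∀ {v w} → adjacent v w ≡ true → adjacent w v ≡ true
  adjacent-sym {v} {w} vw with any-witness n _ vw
  ... | i , vi∧wi = any-intro n _ (trans (∧-comm (incident w i) (incident v i)) vi∧wi)

  neighbours nonNeighbours : Fin m → ℕ
  neighbours    v = count m (λ w → (w ≢ᵇ v) ∧ adjacent v w)
  nonNeighbours v = count m (λ w → (w ≢ᵇ v) ∧ not (adjacent v w))

  ∑-edges-at≡neighbours : ∀ v → ∑[ i < n ] (bit (incident v i) * (size i ∸ 1)) ≡ neighbours v
  ∑-edges-at≡neighbours v = trans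
    (sum-cong-≗ (λ i → sym (bit*others m (λ x → incident x i) v (incident v i) (λ vi → vi))))
    (∑-count-linear m n (_≢ᵇ v) incident v
      (λ x x≢v i j vi xi vj xj → one-edge-through-two-vertices (≢-sym (≢ᵇ⇒≢ x≢v)) vi xi vj xj))

  neighbours+nonNeighbours : ∀ v → neighbours v + nonNeighbours v + 1 ≡ m
  neighbours+nonNeighbours v = begin
    neighbours v + nonNeighbours v + 1
      ≡⟨ cong (_+ 1) (∑-distrib-+ (λ w → bit ((w ≢ᵇ v) ∧ adjacent v w)) _) ⟨
    ∑[ w < m ] (bit ((w ≢ᵇ v) ∧ adjacent v w) + bit ((w ≢ᵇ v) ∧ not (adjacent v w))) + 1
      ≡⟨ cong (_+ 1) (sum-cong-≗ (λ w → bit-split (w ≢ᵇ v) (adjacent v w))) ⟩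
    count m (λ w → (w ≢ᵇ v) ∧ true) + bit true
      ≡⟨ count-remove m (λ _ → true) v ⟩
    count m (λ _ → true)
      ≡⟨ trans (count-const m true) (*-identityʳ m) ⟩
    m ∎
    where
    open ≡-Reasoning
    bit-split : ∀ a b → bit (a ∧ b) + bit (a ∧ not b) ≡ bit (a ∧ true)
    bit-split false _     = refl
    bit-split true  true  = refl
    bit-split true  false = refl

  missingPairs : ℕ
  missingPairs = ∑[ v < m ] nonNeighbours v

  ∑[size∸1]*size+missingPairs : ∑[ i < n ] ((size i ∸ 1) * size i) + missingPairs ≡ m * (m ∸ 1)
  ∑[size∸1]*size+missingPairs = +-cancelʳ-≡ m _ _ (begin
    ∑[ i < n ] ((size i ∸ 1) * size i) + missingPairs + m
      ≡⟨ cong (λ s → s + missingPairs + m) ∑-neighbours ⟨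
    ∑[ v < m ] neighbours v + missingPairs + m
      ≡⟨ cong (_+ m) (∑-distrib-+ neighbours nonNeighbours) ⟨
    ∑[ v < m ] (neighbours v + nonNeighbours v) + m
      ≡⟨ cong (∑[ v < m ] (neighbours v + nonNeighbours v) +_) (trans (count-const m true) (*-identityʳ m)) ⟨
    ∑[ v < m ] (neighbours v + nonNeighbours v) + count m (λ _ → true)
      ≡⟨ ∑-distrib-+ (λ v → neighbours v + nonNeighbours v) (λ _ → 1) ⟨
    ∑[ v < m ] (neighbours v + nonNeighbours v + 1)
      ≡⟨ trans (sum-cong-≗ neighbours+nonNeighbours) (∑-const m m) ⟩
    m * m
      ≡⟨ m*[m∸1]+m≡m*m m ⟨
    m * (m ∸ 1) + m ∎)
    where
    open ≡-Reasoning
    ∑-neighbours : ∑[ v < m ] neighbours v ≡ ∑[ i < n ] ((size i ∸ 1) * size i)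
    ∑-neighbours = begin
      ∑[ v < m ] neighbours v
        ≡⟨ sum-cong-≗ ∑-edges-at≡neighbours ⟨
      ∑[ v < m ] ∑[ i < n ] (bit (incident v i) * (size i ∸ 1))
        ≡⟨ ∑-comm (λ v i → bit (incident v i) * (size i ∸ 1)) ⟩
      ∑[ i < n ] ∑[ v < m ] (bit (incident v i) * (size i ∸ 1))
        ≡⟨ sum-cong-≗ (λ i → trans (sum-cong-≗ {m} (λ v → *-comm (bit (incident v i)) _))
                                        (sym (*-distribˡ-sum (size i ∸ 1) (λ v → bit (incident v i)))))  ⟩
      ∑[ i < n ] ((size i ∸ 1) * size i) ∎

  isEven : Fin n → Bool
  isEven i = not (odd (size i))

  evenDegree : Fin m → ℕ
  evenDegree v = count n (λ i → isEven i ∧ incident v i)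

  #even : ℕ
  #even = count n isEven

  nonNeighbours-parity : odd m ≡ true → ∀ v → odd (nonNeighbours v) ≡ odd (evenDegree v)
  nonNeighbours-parity odd-m v = trans (sym neighbours∼nonNeighbours) neighbours∼evenDegree
    where
    neighbours∼nonNeighbours : odd (neighbours v) ≡ odd (nonNeighbours v)
    neighbours∼nonNeighbours = even-sum⇒same-parity (neighbours v) (nonNeighbours v) (not-injective (begin
      not (odd (neighbours v + nonNeighbours v))  ≡⟨ cong odd (+-comm 1 (neighbours v + nonNeighbours v)) ⟩
      odd (neighbours v + nonNeighbours v + 1)    ≡⟨ cong odd (neighbours+nonNeighbours v) ⟩
      odd m                                       ≡⟨ odd-m ⟩
      true                                        ∎))
      where open ≡-Reasoning

    even-term : ∀ i → odd (bit (incident v i) * (size i ∸ 1) + bit (isEven i ∧ incident v i)) ≡ false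
    even-term i with incident v i in vi
    ... | true  = trans (cong (λ b → odd ((size i ∸ 1) + 0 + bit b)) (∧-identityʳ (isEven i)))
                        (trans (cong (λ k → odd (k + bit (isEven i))) (+-identityʳ (size i ∸ 1)))
                               (odd-[k∸1]+even (size i) (incident⇒size>0 {v} vi)))
    ... | false = cong (λ b → odd (bit b)) (∧-zeroʳ (isEven i))

    neighbours∼evenDegree : odd (neighbours v) ≡ odd (evenDegree v)
    neighbours∼evenDegree = even-sum⇒same-parity (neighbours v) (evenDegree v) (begin
      odd (neighbours v + evenDegree v)
        ≡⟨ cong (λ c → odd (c + evenDegree v)) (∑-edges-at≡neighbours v) ⟨
      odd (∑[ i < n ] (bit (incident v i) * (size i ∸ 1)) + evenDegree v)
        ≡⟨ cong odd (∑-distrib-+ (λ i → bit (incident v i) * (size i ∸ 1)) _) ⟨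
      odd (∑[ i < n ] (bit (incident v i) * (size i ∸ 1) + bit (isEven i ∧ incident v i)))
        ≡⟨ odd-∑ _ even-term ⟩
      false ∎)
      where open ≡-Reasoning

  meets : Fin n → Fin n → Bool
  meets A i = any m (λ v → incident v A ∧ incident v i)

  meets-sym : ∀ {A i} → meets A i ≡ true → meets i A ≡ true
  meets-sym {A} {i} Ai with any-witness m _ Ai
  ... | v , vA∧vi = any-intro m _ (trans (∧-comm (incident v i) (incident v A)) vA∧vi)

  evenOverlap : Fin n → ℕ
  evenOverlap A = ∑[ v < m ] (bit (incident v A) * (evenDegree v ∸ 1))

  evenOverlap≡count : ∀ {A} → isEven A ≡ true →
                      evenOverlap A ≡ count n (λ i → ((i ≢ᵇ A) ∧ isEven i) ∧ meets A i)
  evenOverlap≡count {A} evenA = trans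
    (sum-cong-≗ λ v → begin
      bit (incident v A) * (evenDegree v ∸ 1)
        ≡⟨ bit*others n (λ i → isEven i ∧ incident v i) A (incident v A) (cong₂ _∧_ evenA) ⟨
      bit (incident v A) * count n (λ i → (i ≢ᵇ A) ∧ (isEven i ∧ incident v i))
        ≡⟨ cong (bit (incident v A) *_) (count-cong n (λ i → ∧-assoc (i ≢ᵇ A) _ _)) ⟨
      bit (incident v A) * count n (λ i → ((i ≢ᵇ A) ∧ isEven i) ∧ incident v i) ∎)
    (∑-count-linear n m (λ i → (i ≢ᵇ A) ∧ isEven i) (λ i v → incident v i) A
      (λ i i≢A _ _ → one-vertex-in-two-edges (≢-sym (≢ᵇ⇒≢ (∧-true⁻ˡ (i ≢ᵇ A) i≢A)))))
    where open ≡-Reasoning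

  evenOverlap<#even : ∀ {A} → isEven A ≡ true → evenOverlap A < #even
  evenOverlap<#even {A} evenA = begin
    suc (evenOverlap A)                                  ≡⟨ +-comm 1 _ ⟩
    evenOverlap A + 1                                    ≤⟨ +-monoˡ-≤ 1 (≤-trans (≤-reflexive (evenOverlap≡count evenA))
                                                              (count-mono n (λ i → ∧-true⁻ˡ ((i ≢ᵇ A) ∧ isEven i)))) ⟩
    count n (λ i → (i ≢ᵇ A) ∧ isEven i) + 1             ≡⟨ cong (λ b → count n (λ i → (i ≢ᵇ A) ∧ isEven i) + bit b) evenA ⟨
    count n (λ i → (i ≢ᵇ A) ∧ isEven i) + bit (isEven A) ≡⟨ count-remove n isEven A ⟩
    #even                                                ∎
    where open ≤-Reasoning

  evenDegree≥2 : odd m ≡ true → ∀ {v A} → nonNeighbours v ≡ 0 → isEven A ≡ true → incident v A ≡ true →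
                 2 ≤ evenDegree v
  evenDegree≥2 odd-m {v} {A} no-nonNeighbours evenA vA =
    even⇒2≤ (evenDegree v)
      (trans (sym (nonNeighbours-parity odd-m v)) (cong odd no-nonNeighbours))
      (count-positive n (λ i → isEven i ∧ incident v i) (cong₂ _∧_ evenA vA))

  count≤evenOverlap : ∀ A (p : Fin m → Bool) →
    (∀ v → p v ≡ true → incident v A ≡ true × 2 ≤ evenDegree v) → count m p ≤ evenOverlap A
  count≤evenOverlap A p p⇒ = ∑-mono-≤ term
    where
    term : ∀ v → bit (p v) ≤ bit (incident v A) * (evenDegree v ∸ 1)
    term v with p v in pv
    ... | false = z≤n
    ... | true with p⇒ v pv
    ...   | vA , 2≤e rewrite vA = ≤-trans (∸-monoˡ-≤ 1 2≤e) (≤-reflexive (sym (*-identityˡ _)))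

  surplus : Fin n → ℕ
  surplus A = ∑[ v < m ] (bit (incident v A) * (evenDegree v ∸ 2))

  evenOverlap≡size+surplus : ∀ A → (∀ v → incident v A ≡ true → 2 ≤ evenDegree v) →
                             evenOverlap A ≡ size A + surplus A
  evenOverlap≡size+surplus A 2≤e =
    trans (sum-cong-≗ term) (∑-distrib-+ (λ v → bit (incident v A)) _)
    where
    term : ∀ v → bit (incident v A) * (evenDegree v ∸ 1)
               ≡ bit (incident v A) + bit (incident v A) * (evenDegree v ∸ 2)
    term v with incident v A in vA
    ... | false = refl
    ... | true  with evenDegree v | 2≤e v vA
    ...   | suc (suc e) | _           = refl
    ...   | suc zero    | s≤s ()

  size+excess≤evenOverlap : ∀ A {a} → (∀ v → incident v A ≡ true → 2 ≤ evenDegree v) →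
                            incident a A ≡ true → size A + (evenDegree a ∸ 2) ≤ evenOverlap A
  size+excess≤evenOverlap A {a} 2≤e aA = begin
    size A + (evenDegree a ∸ 2)                            ≡⟨ cong (size A +_) (*-identityˡ (evenDegree a ∸ 2)) ⟨
    size A + bit true * (evenDegree a ∸ 2)                 ≡⟨ cong (λ b → size A + bit b * (evenDegree a ∸ 2)) aA ⟨
    size A + bit (incident a A) * (evenDegree a ∸ 2)       ≤⟨ +-monoʳ-≤ (size A) (term≤∑ (λ v → bit (incident v A) * (evenDegree v ∸ 2)) a) ⟩
    size A + surplus A                                     ≡⟨ evenOverlap≡size+surplus A 2≤e ⟨
    evenOverlap A                                          ∎
    where open ≤-Reasoning

  surplus-witness : ∀ A → 0 < surplus A → ∃[ a ] incident a A ≡ true × 2 < evenDegree a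
  surplus-witness A 0<surplus with ∑-positive (λ v → bit (incident v A) * (evenDegree v ∸ 2)) 0<surplus
  ... | a , 0<term with incident a A in aA
  ...   | true  = a , aA , m∸n≢0⇒n<m (n>0⇒n≢0 (subst (0 <_) (+-identityʳ _) 0<term))
  ...   | false = contradiction 0<term λ ()

  another-even-edge-through : ∀ {P a} → isEven P ≡ true → incident a P ≡ true → 2 ≤ evenDegree a →
                              ∃[ B ] B ≢ P × isEven B ≡ true × incident a B ≡ true
  another-even-edge-through {P} {a} evenP aP 2≤e
    with count-witness n (λ i → (i ≢ᵇ P) ∧ (isEven i ∧ incident a i))
           (subst (0 <_) (sym (count-others n (λ i → isEven i ∧ incident a i) (cong₂ _∧_ evenP aP))) (∸-monoˡ-≤ 1 2≤e))
  ... | B , B≢P∧evenB∧aB =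
    B , ≢ᵇ⇒≢ (∧-true⁻ˡ (B ≢ᵇ P) B≢P∧evenB∧aB)
      , ∧-true⁻ˡ (isEven B) (∧-true⁻ʳ (B ≢ᵇ P) B≢P∧evenB∧aB)
      , ∧-true⁻ʳ (isEven B) (∧-true⁻ʳ (B ≢ᵇ P) B≢P∧evenB∧aB)

  maximal-overlap⇒meets-all : ∀ {B} → isEven B ≡ true → evenOverlap B ≡ #even ∸ 1 →
                              ∀ {A} → A ≢ B → isEven A ≡ true → meets B A ≡ true
  maximal-overlap⇒meets-all {B} evenB maximal {A} A≢B evenA =
    ∧-true⁻ʳ ((A ≢ᵇ B) ∧ isEven A)
      (count-≡⇒⊇ n (λ i → ∧-true⁻ˡ ((i ≢ᵇ B) ∧ isEven i))
        (trans (sym (evenOverlap≡count evenB)) (trans maximal (sym (count-others n isEven evenB))))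
        A (cong₂ _∧_ (≢⇒≢ᵇ A≢B) evenA))

  meets-all⇒#even∸1≤evenOverlap : ∀ {P} → isEven P ≡ true →
    (∀ {B} → B ≢ P → isEven B ≡ true → meets P B ≡ true) → #even ∸ 1 ≤ evenOverlap P
  meets-all⇒#even∸1≤evenOverlap {P} evenP meets-P = begin
    #even ∸ 1                                          ≡⟨ count-others n isEven evenP ⟨
    count n (λ i → (i ≢ᵇ P) ∧ isEven i)                ≤⟨ count-mono n (λ i others-i → trans (cong (_∧ meets P i) others-i)
                                                            (meets-P (≢ᵇ⇒≢ (∧-true⁻ˡ (i ≢ᵇ P) others-i)) (∧-true⁻ʳ (i ≢ᵇ P) others-i))) ⟩
    count n (λ i → ((i ≢ᵇ P) ∧ isEven i) ∧ meets P i)  ≡⟨ evenOverlap≡count evenP ⟨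
    evenOverlap P                                      ∎
    where open ≤-Reasoning

  record NonAdjacentPair : Set where
    field
      v w                  : Fin m
      v≢w                  : v ≢ w
      non-adjacent         : adjacent v w ≡ false
      nonNeighbours-v      : nonNeighbours v ≡ 1
      nonNeighbours-others : ∀ y → y ≢ v → y ≢ w → nonNeighbours y ≡ 0

  missingPairs≡2⇒nonAdjacentPair : missingPairs ≡ 2 → NonAdjacentPair
  missingPairs≡2⇒nonAdjacentPair missing≡2
    with ∑-positive nonNeighbours (subst (0 <_) (sym missing≡2) (s≤s z≤n))
  ... | v , 0<dv with count-witness m _ 0<dv
  ...   | w , w≢v∧¬vw = record
    { v = v ; w = w ; v≢w = v≢w ; non-adjacent = ¬vw
    ; nonNeighbours-v = ≤-antisym (+-cancelʳ-≤ 1 (nonNeighbours v) 1 (≤-trans (+-monoʳ-≤ (nonNeighbours v) 0<dw) dv+dw≤2)) 0<dv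
    ; nonNeighbours-others = λ y y≢v y≢w → n≤0⇒n≡0 (+-cancelʳ-≤ 2 (nonNeighbours y) 0 (begin
        nonNeighbours y + 2                                   ≤⟨ +-monoʳ-≤ (nonNeighbours y) (+-mono-≤ 0<dv 0<dw) ⟩
        nonNeighbours y + (nonNeighbours v + nonNeighbours w) ≡⟨ +-assoc (nonNeighbours y) _ _ ⟨
        nonNeighbours y + nonNeighbours v + nonNeighbours w   ≤⟨ three-terms≤∑ nonNeighbours y≢v y≢w v≢w ⟩
        missingPairs                                          ≡⟨ missing≡2 ⟩
        2                                                     ∎))
    }
    where
    open ≤-Reasoning
    v≢w : v ≢ w
    v≢w = ≢-sym (≢ᵇ⇒≢ (∧-true⁻ˡ (w ≢ᵇ v) w≢v∧¬vw))
    ¬vw : adjacent v w ≡ false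
    ¬vw = not-injective (∧-true⁻ʳ (w ≢ᵇ v) w≢v∧¬vw)
    ¬wv : adjacent w v ≡ false
    ¬wv with adjacent w v in wv
    ... | false = refl
    ... | true  = contradiction (trans (sym (adjacent-sym wv)) ¬vw) λ ()
    0<dw : 0 < nonNeighbours w
    0<dw = count-positive m (λ x → (x ≢ᵇ w) ∧ not (adjacent w x)) (cong₂ _∧_ (≢⇒≢ᵇ v≢w) (cong not ¬wv))
    dv+dw≤2 : nonNeighbours v + nonNeighbours w ≤ 2
    dv+dw≤2 = subst (nonNeighbours v + nonNeighbours w ≤_) missing≡2 (two-terms≤∑ nonNeighbours v≢w)

  ∑defect : ℕ
  ∑defect = ∑[ i < n ] defect (size i)

  Size3or4 : Fin n → Set
  Size3or4 i = size i ≡ 3 + bit (isEven i)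

  size3or4-even⇒size≡4 : ∀ {A} → Size3or4 A → isEven A ≡ true → size A ≡ 4
  size3or4-even⇒size≡4 size3or4 evenA = trans size3or4 (cong (λ b → 3 + bit b) evenA)

  ∑size-all-3or4 : (∀ i → Size3or4 i) → ∑[ i < n ] size i ≡ n * 3 + #even
  ∑size-all-3or4 size3or4 =
    trans (sum-cong-≗ size3or4) (trans (∑-distrib-+ (λ _ → 3) (bit ∘ isEven)) (cong (_+ #even) (∑-const n 3)))

  ∑size-3or4-except : ∀ P → (∀ {i} → i ≢ P → Size3or4 i) →
                      ∑[ i < n ] size i + (3 + bit (isEven P)) ≡ n * 3 + #even + size P
  ∑size-3or4-except P size3or4 = trans (∑-update size (λ i → 3 + bit (isEven i)) P (λ i → size3or4))
    (cong (_+ size P) (trans (∑-distrib-+ (λ _ → 3) (bit ∘ isEven)) (cong (_+ #even) (∑-const n 3))))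

  ∑defect≡0⇒size3or4 : ∑defect ≡ 0 → ∀ i → Size3or4 i
  ∑defect≡0⇒size3or4 ∑defect≡0 i = defect≡0⇒≡3+bit (size i) (∑≡0⇒≡0 (defect ∘ size) ∑defect≡0 i)

  size3or4⇒#even≡ : ∀ {x} → (∀ i → Size3or4 i) → ∑[ i < n ] size i ≡ n * 3 + x → #even ≡ x
  size3or4⇒#even≡ {x} size3or4 ∑size≡ = +-cancelˡ-≡ (n * 3) #even x (trans (sym (∑size-all-3or4 size3or4)) ∑size≡)

  even-edge-other-than : ∀ P → bit (isEven P) < #even → ∃[ A ] A ≢ P × isEven A ≡ true
  even-edge-other-than P bit<#even
    with count-witness n (λ i → (i ≢ᵇ P) ∧ isEven i)
           (+-cancelʳ-< (bit (isEven P)) 0 (count n (λ i → (i ≢ᵇ P) ∧ isEven i)) (subst (bit (isEven P) <_) (sym (count-remove n isEven P)) bit<#even))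
  ... | A , A≢P∧evenA = A , ≢ᵇ⇒≢ (∧-true⁻ˡ (A ≢ᵇ P) A≢P∧evenA) , ∧-true⁻ʳ (A ≢ᵇ P) A≢P∧evenA

  large-∑size⇒tight : m * (m ∸ 1) / 6 + 2 * n ≤ ∑[ i < n ] size i →
                      ∑[ i < n ] size i ≡ m * (m ∸ 1) / 6 + 2 * n × ∑defect + missingPairs ≡ m * (m ∸ 1) % 6
  large-∑size⇒tight = squeeze {D = missingPairs} {∑defect} {∑[ i < n ] size i} {m * (m ∸ 1) / 6} {n} {m * (m ∸ 1) % 6}
    (m%n<n (m * (m ∸ 1)) 6)
    (trans ∑[size∸1]*size+missingPairs (trans (m≡m%n+[m/n]*n (m * (m ∸ 1)) 6) (cong (m * (m ∸ 1) % 6 +_) (*-comm (m * (m ∸ 1) / 6) 6))))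
    (∑-defect size)

  module _ (odd-m : odd m ≡ true) where

    evenDegree≥2-on-even-edges : missingPairs ≡ 0 → ∀ {A} → isEven A ≡ true →
                                 ∀ v → incident v A ≡ true → 2 ≤ evenDegree v
    evenDegree≥2-on-even-edges no-missing evenA v =
      evenDegree≥2 odd-m (∑≡0⇒≡0 nonNeighbours no-missing v) evenA

    size≤evenOverlap : missingPairs ≡ 0 → ∀ {A} → isEven A ≡ true → size A ≤ evenOverlap A
    size≤evenOverlap no-missing {A} evenA =
      subst (size A ≤_) (sym (evenOverlap≡size+surplus A (evenDegree≥2-on-even-edges no-missing evenA)))
        (m≤m+n (size A) (surplus A))

    size<#even : missingPairs ≡ 0 → ∀ {A} → isEven A ≡ true → size A < #even
    size<#even no-missing evenA = ≤-<-trans (size≤evenOverlap no-missing evenA) (evenOverlap<#even evenA)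

    nonAdjacentPair⇒0<#even : NonAdjacentPair → 0 < #even
    nonAdjacentPair⇒0<#even pair = n≢0⇒n>0 λ #even≡0 →
      contradiction (trans (sym (cong odd nonNeighbours-v)) (trans (nonNeighbours-parity odd-m v) (cong odd (e≡0 #even≡0)))) λ ()
      where
      open NonAdjacentPair pair
      e≡0 : #even ≡ 0 → evenDegree v ≡ 0
      e≡0 #even≡0 = n≤0⇒n≡0 (subst (evenDegree v ≤_) #even≡0 (count-mono n (λ i → ∧-true⁻ˡ (isEven i))))

    missingPairs≡2⇒4≤#even : missingPairs ≡ 2 → (∀ {A} → isEven A ≡ true → size A ≡ 4) → 4 ≤ #even
    missingPairs≡2⇒4≤#even missing≡2 even⇒size4 = ≤-trans (s≤s 3≤overlap) (evenOverlap<#even evenA)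
      where
      pair : NonAdjacentPair
      pair = missingPairs≡2⇒nonAdjacentPair missing≡2
      open NonAdjacentPair pair

      A-witness : ∃[ A ] isEven A ≡ true
      A-witness = count-witness n isEven (nonAdjacentPair⇒0<#even pair)
      A : Fin n
      A = proj₁ A-witness
      evenA : isEven A ≡ true
      evenA = proj₂ A-witness

      others : Fin m → Bool
      others y = (y ≢ᵇ w) ∧ ((y ≢ᵇ v) ∧ incident y A)

      at-most-one : bit (incident w A) + bit (incident v A) ≤ 1
      at-most-one = bit+bit≤1 (incident w A) (incident v A)
        (λ wA vA → contradiction (trans (sym (any-intro n _ (cong₂ _∧_ vA wA))) non-adjacent) λ ())

      3≤others : 3 ≤ count m others
      3≤others = +-cancelʳ-≤ 1 3 (count m others) (begin
        4                                                                ≡⟨ even⇒size4 evenA ⟨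
        size A                                                           ≡⟨ count-remove₂ m (λ y → incident y A) (≢⇒≢ᵇ (≢-sym v≢w)) ⟨
        count m others + bit (incident w A) + bit (incident v A)         ≡⟨ +-assoc (count m others) _ _ ⟩
        count m others + (bit (incident w A) + bit (incident v A))       ≤⟨ +-monoʳ-≤ (count m others) at-most-one ⟩
        count m others + 1                                               ∎)
        where open ≤-Reasoning

      3≤overlap : 3 ≤ evenOverlap A
      3≤overlap = ≤-trans 3≤others (count≤evenOverlap A others λ y others-y →
        let y≢w = ≢ᵇ⇒≢ (∧-true⁻ˡ (y ≢ᵇ w) others-y)
            y≢v∧yA = ∧-true⁻ʳ (y ≢ᵇ w) others-y
            y≢v = ≢ᵇ⇒≢ (∧-true⁻ˡ (y ≢ᵇ v) y≢v∧yA)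
            yA = ∧-true⁻ʳ (y ≢ᵇ v) y≢v∧yA
        in yA , evenDegree≥2 odd-m (nonNeighbours-others y y≢v y≢w) evenA yA)

    size4-even-edge-meets-all : missingPairs ≡ 0 → #even ≡ 5 → ∀ {B} → isEven B ≡ true → size B ≡ 4 →
                                ∀ {A} → A ≢ B → isEven A ≡ true → meets B A ≡ true
    size4-even-edge-meets-all no-missing #even≡5 {B} evenB sizeB≡4 = maximal-overlap⇒meets-all evenB
      (trans (≤-antisym (s≤s⁻¹ (subst (evenOverlap B <_) #even≡5 (evenOverlap<#even evenB)))
                        (subst (_≤ evenOverlap B) sizeB≡4 (size≤evenOverlap no-missing evenB)))
             (cong (_∸ 1) (sym #even≡5)))

    #even≢5 : missingPairs ≡ 0 → ∀ {P} → size P ≡ 2 →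
              (∀ {B} → B ≢ P → isEven B ≡ true → size B ≡ 4) → #even ≢ 5
    #even≢5 no-missing {P} sizeP≡2 others≡4 #even≡5 =
      <⇒≱ 4<overlapB (s≤s⁻¹ (subst (evenOverlap B <_) #even≡5 (evenOverlap<#even evenB)))
      where
      evenP : isEven P ≡ true
      evenP = cong (not ∘ odd) sizeP≡2

      2≤e : ∀ {A} → isEven A ≡ true → ∀ v → incident v A ≡ true → 2 ≤ evenDegree v
      2≤e = evenDegree≥2-on-even-edges no-missing

      4≤overlapP : 2 + 2 ≤ size P + surplus P
      4≤overlapP = begin
        4                   ≡⟨ cong (_∸ 1) #even≡5 ⟨
        #even ∸ 1           ≤⟨ meets-all⇒#even∸1≤evenOverlap evenP (λ B≢P evenB →
                                 meets-sym (size4-even-edge-meets-all no-missing #even≡5 evenB (others≡4 B≢P evenB) (≢-sym B≢P) evenP)) ⟩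
        evenOverlap P       ≡⟨ evenOverlap≡size+surplus P (2≤e evenP) ⟩
        size P + surplus P  ∎
        where open ≤-Reasoning

      a-witness : ∃[ a ] incident a P ≡ true × 2 < evenDegree a
      a-witness = surplus-witness P (≤-trans (s≤s z≤n) (+-cancelˡ-≤ 2 2 (surplus P) (subst (λ k → 2 + 2 ≤ k + surplus P) sizeP≡2 4≤overlapP)))

      a : Fin m
      a = proj₁ a-witness

      4≤ea : 4 ≤ evenDegree a
      4≤ea = even⇒4≤ (evenDegree a)
        (trans (sym (nonNeighbours-parity odd-m a)) (cong odd (∑≡0⇒≡0 nonNeighbours no-missing a)))
        (proj₂ (proj₂ a-witness))

      B-witness : ∃[ B ] B ≢ P × isEven B ≡ true × incident a B ≡ true
      B-witness = another-even-edge-through evenP (proj₁ (proj₂ a-witness)) (≤-trans (s≤s (s≤s z≤n)) 4≤ea)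

      B : Fin n
      B = proj₁ B-witness

      evenB : isEven B ≡ true
      evenB = proj₁ (proj₂ (proj₂ B-witness))

      4<overlapB : 4 < evenOverlap B
      4<overlapB = begin-strict
        4                              <⟨ s≤s (s≤s (s≤s (s≤s (s≤s z≤n)))) ⟩
        4 + 2                          ≤⟨ +-monoʳ-≤ 4 (∸-monoˡ-≤ 2 4≤ea) ⟩
        4 + (evenDegree a ∸ 2)         ≡⟨ cong (_+ (evenDegree a ∸ 2)) (others≡4 (proj₁ (proj₂ B-witness)) evenB) ⟨
        size B + (evenDegree a ∸ 2)    ≤⟨ size+excess≤evenOverlap B (2≤e evenB) (proj₂ (proj₂ (proj₂ B-witness))) ⟩
        evenOverlap B                  ∎
        where open ≤-Reasoning

    ∑defect+missingPairs≢0 : ∀ {x} → x ≡ 1 ⊎ x ≡ 2 ⊎ x ≡ 3 ⊎ x ≡ 4 → ∑[ i < n ] size i ≡ n * 3 + x →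
                             ∑defect + missingPairs ≡ 0 → ⊥
    ∑defect+missingPairs≢0 {x} x∈ ∑size≡ G+D≡0 =
      <⇒≱ (size<#even (m+n≡0⇒n≡0 ∑defect G+D≡0) evenA) (begin
        #even   ≡⟨ #even≡x ⟩
        x       ≤⟨ x≤4 x∈ ⟩
        4       ≡⟨ size3or4-even⇒size≡4 (size3or4 A) evenA ⟨
        size A  ∎)
      where
      open ≤-Reasoning
      x≤4 : x ≡ 1 ⊎ x ≡ 2 ⊎ x ≡ 3 ⊎ x ≡ 4 → x ≤ 4
      x≤4 (inj₁ refl)               = s≤s z≤n
      x≤4 (inj₂ (inj₁ refl))        = s≤s (s≤s z≤n)
      x≤4 (inj₂ (inj₂ (inj₁ refl))) = s≤s (s≤s (s≤s z≤n))
      x≤4 (inj₂ (inj₂ (inj₂ refl))) = ≤-refl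
      0<x : x ≡ 1 ⊎ x ≡ 2 ⊎ x ≡ 3 ⊎ x ≡ 4 → 0 < x
      0<x (inj₁ refl)               = s≤s z≤n
      0<x (inj₂ (inj₁ refl))        = s≤s z≤n
      0<x (inj₂ (inj₂ (inj₁ refl))) = s≤s z≤n
      0<x (inj₂ (inj₂ (inj₂ refl))) = s≤s z≤n
      size3or4 : ∀ i → Size3or4 i
      size3or4 = ∑defect≡0⇒size3or4 (m+n≡0⇒m≡0 ∑defect G+D≡0)
      #even≡x : #even ≡ x
      #even≡x = size3or4⇒#even≡ size3or4 ∑size≡
      A-witness : ∃[ A ] isEven A ≡ true
      A-witness = count-witness n isEven (subst (0 <_) (sym #even≡x) (0<x x∈))
      A : Fin n
      A = proj₁ A-witness
      evenA : isEven A ≡ true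
      evenA = proj₂ A-witness

    missingPairs≢2-without-defect : ∀ {x} → x ≤ 3 → ∑[ i < n ] size i ≡ n * 3 + x → ∑defect ≡ 0 → missingPairs ≡ 2 → ⊥
    missingPairs≢2-without-defect x≤3 ∑size≡ ∑defect≡0 missing≡2 =
      <⇒≱ (≤-trans (missingPairs≡2⇒4≤#even missing≡2 (size3or4-even⇒size≡4 (size3or4 _))) (≤-reflexive (size3or4⇒#even≡ size3or4 ∑size≡))) x≤3
      where
      size3or4 : ∀ i → Size3or4 i
      size3or4 = ∑defect≡0⇒size3or4 ∑defect≡0

    other-even-edge⇒4<#even : missingPairs ≡ 0 → ∀ {P} → (∀ {i} → i ≢ P → Size3or4 i) →
                              bit (isEven P) < #even → 4 < #even
    other-even-edge⇒4<#even no-missing {P} size3or4 bit<#even =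
      let A , A≢P , evenA = even-edge-other-than P bit<#even
      in subst (_< #even) (size3or4-even⇒size≡4 (size3or4 A≢P) evenA) (size<#even no-missing evenA)

    no-defective-edge-of-size-2 : ∀ {x P} → x ≡ 0 ⊎ x ≡ 1 ⊎ x ≡ 3 → ∑[ i < n ] size i ≡ n * 3 + x →
                                  missingPairs ≡ 0 → size P ≡ 2 → (∀ {i} → i ≢ P → Size3or4 i) → ⊥
    no-defective-edge-of-size-2 {x} {P} x∈ ∑size≡ no-missing sizeP≡2 size3or4 = by-cases x∈
      where
      evenP : isEven P ≡ true
      evenP = cong (not ∘ odd) sizeP≡2

      #even≡x+2 : #even ≡ x + 2
      #even≡x+2 = +-cancelˡ-≡ (n * 3 + 2) #even (x + 2) (begin
        n * 3 + 2 + #even                ≡⟨ m+n+o≡m+o+n (n * 3) 2 #even ⟩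
        n * 3 + #even + 2                ≡⟨ cong (n * 3 + #even +_) sizeP≡2 ⟨
        n * 3 + #even + size P           ≡⟨ ∑size-3or4-except P size3or4 ⟨
        ∑[ i < n ] size i + (3 + bit (isEven P))  ≡⟨ cong₂ (λ s b → s + (3 + bit b)) ∑size≡ evenP ⟩
        n * 3 + x + 4                    ≡⟨ regroup (n * 3) x ⟩
        n * 3 + 2 + (x + 2)              ∎)
        where
        open ≡-Reasoning
        regroup : ∀ a x → a + x + 4 ≡ a + 2 + (x + 2)
        regroup = solve-∀

      by-cases : x ≡ 0 ⊎ x ≡ 1 ⊎ x ≡ 3 → ⊥
      by-cases (inj₁ refl) = <⇒≱ (size<#even no-missing evenP) (≤-reflexive (trans #even≡x+2 (sym sizeP≡2)))
      by-cases (inj₂ (inj₁ refl)) = <⇒≱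
        (other-even-edge⇒4<#even no-missing size3or4 (subst₂ (λ b e → bit b < e) (sym evenP) (sym #even≡x+2) (s≤s (s≤s z≤n))))
        (≤-trans (≤-reflexive #even≡x+2) (n≤1+n 3))
      by-cases (inj₂ (inj₂ refl)) =
        #even≢5 no-missing sizeP≡2 (λ B≢P → size3or4-even⇒size≡4 (size3or4 B≢P)) #even≡x+2

    no-defective-edge-of-size-5 : ∀ {x P} → x ≡ 0 ⊎ x ≡ 1 ⊎ x ≡ 3 → ∑[ i < n ] size i ≡ n * 3 + x →
                                  missingPairs ≡ 0 → size P ≡ 5 → (∀ {i} → i ≢ P → Size3or4 i) → ⊥
    no-defective-edge-of-size-5 {x} {P} x∈ ∑size≡ no-missing sizeP≡5 size3or4 = by-cases x∈
      where
      oddP : isEven P ≡ false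
      oddP = cong (not ∘ odd) sizeP≡5

      x≡#even+2 : x ≡ #even + 2
      x≡#even+2 = +-cancelˡ-≡ (n * 3 + 3) x (#even + 2) (begin
        n * 3 + 3 + x                             ≡⟨ m+n+o≡m+o+n (n * 3) 3 x ⟩
        n * 3 + x + 3                             ≡⟨ cong₂ (λ s b → s + (3 + bit b)) ∑size≡ oddP ⟨
        ∑[ i < n ] size i + (3 + bit (isEven P))  ≡⟨ ∑size-3or4-except P size3or4 ⟩
        n * 3 + #even + size P                    ≡⟨ cong (n * 3 + #even +_) sizeP≡5 ⟩
        n * 3 + #even + 5                         ≡⟨ regroup (n * 3) #even ⟩
        n * 3 + 3 + (#even + 2)                   ∎)
        where
        open ≡-Reasoning
        regroup : ∀ a e → a + e + 5 ≡ a + 3 + (e + 2)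
        regroup = solve-∀

      2≤x : 2 ≤ x
      2≤x = subst (2 ≤_) (sym x≡#even+2) (m≤n+m 2 #even)

      by-cases : x ≡ 0 ⊎ x ≡ 1 ⊎ x ≡ 3 → ⊥
      by-cases (inj₁ refl)        = contradiction 2≤x λ ()
      by-cases (inj₂ (inj₁ refl)) = contradiction 2≤x λ { (s≤s ()) }
      by-cases (inj₂ (inj₂ refl)) = <⇒≱
        (other-even-edge⇒4<#even no-missing size3or4 (subst₂ (λ b e → bit b < e) (sym oddP) (sym #even≡1) (s≤s z≤n)))
        (≤-trans (≤-reflexive #even≡1) (s≤s z≤n))
        where
        #even≡1 : #even ≡ 1
        #even≡1 = +-cancelʳ-≡ 2 #even 1 (sym x≡#even+2)

    ∑defect+missingPairs≢2-with-defect : ∀ {x} → x ≡ 0 ⊎ x ≡ 1 ⊎ x ≡ 3 → ∑[ i < n ] size i ≡ n * 3 + x →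
                                         ∑defect + missingPairs ≡ 2 → 0 < ∑defect → ⊥
    ∑defect+missingPairs≢2-with-defect x∈ ∑size≡ G+D≡2 0<G = by-size (proj₂ P-defect)
      where
      P-witness : ∃[ P ] 0 < defect (size P)
      P-witness = ∑-positive (defect ∘ size) 0<G
      P : Fin n
      P = proj₁ P-witness

      G≤2 : ∑defect ≤ 2
      G≤2 = m+n≤o⇒m≤o ∑defect (≤-reflexive G+D≡2)

      P-defect : defect (size P) ≡ 2 × (size P ≡ 2 ⊎ size P ≡ 5)
      P-defect = defect∈[1,2]⇒ (size P) (proj₂ P-witness) (≤-trans (term≤∑ (defect ∘ size) P) G≤2)

      2≤G : 2 ≤ ∑defect
      2≤G = subst (_≤ ∑defect) (proj₁ P-defect) (term≤∑ (defect ∘ size) P)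

      no-missing : missingPairs ≡ 0
      no-missing = n≤0⇒n≡0 (+-cancelˡ-≤ 2 missingPairs 0 (≤-trans (+-monoˡ-≤ missingPairs 2≤G) (≤-reflexive G+D≡2)))

      size3or4 : ∀ {i} → i ≢ P → Size3or4 i
      size3or4 {i} i≢P = defect≡0⇒≡3+bit (size i) (n≤0⇒n≡0 (+-cancelʳ-≤ 2 (defect (size i)) 0 (begin
        defect (size i) + 2               ≡⟨ cong (defect (size i) +_) (proj₁ P-defect) ⟨
        defect (size i) + defect (size P) ≤⟨ two-terms≤∑ (defect ∘ size) i≢P ⟩
        ∑defect                           ≤⟨ G≤2 ⟩
        2                                 ∎)))
        where open ≤-Reasoning

      by-size : size P ≡ 2 ⊎ size P ≡ 5 → ⊥
      by-size (inj₁ sizeP≡2) = no-defective-edge-of-size-2 x∈ ∑size≡ no-missing sizeP≡2 size3or4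
      by-size (inj₂ sizeP≡5) = no-defective-edge-of-size-5 x∈ ∑size≡ no-missing sizeP≡5 size3or4

    ∑defect+missingPairs≢2 : ∀ {x} → x ≡ 0 ⊎ x ≡ 1 ⊎ x ≡ 3 → ∑[ i < n ] size i ≡ n * 3 + x → ∑defect + missingPairs ≡ 2 → ⊥
    ∑defect+missingPairs≢2 x∈ ∑size≡ G+D≡2 = by-defect (∑defect ≟ 0)
      where
      x≤3 : ∀ {x} → x ≡ 0 ⊎ x ≡ 1 ⊎ x ≡ 3 → x ≤ 3
      x≤3 (inj₁ refl)        = z≤n
      x≤3 (inj₂ (inj₁ refl)) = s≤s z≤n
      x≤3 (inj₂ (inj₂ refl)) = ≤-refl
      by-defect : Dec (∑defect ≡ 0) → ⊥
      by-defect (yes G≡0) = missingPairs≢2-without-defect (x≤3 x∈) ∑size≡ G≡0 (trans (cong (_+ missingPairs) (sym G≡0)) G+D≡2)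
      by-defect (no  G≢0) = ∑defect+missingPairs≢2-with-defect x∈ ∑size≡ G+D≡2 (n≢0⇒n>0 G≢0)

    tight-count-impossible : ∀ {x} → InS m x → ∑[ i < n ] size i ≡ n * 3 + x →
                             ∑defect + missingPairs ≡ m * (m ∸ 1) % 6 → ⊥
    tight-count-impossible (inj₁ (inj₁ m%6≡1 , x∈)) ∑size≡ G+D≡ = ∑defect+missingPairs≢0 x∈ ∑size≡ (trans G+D≡ (m*[m∸1]%6 m 0 m%6≡1))
    tight-count-impossible (inj₁ (inj₂ m%6≡3 , x∈)) ∑size≡ G+D≡ = ∑defect+missingPairs≢0 x∈ ∑size≡ (trans G+D≡ (m*[m∸1]%6 m 2 m%6≡3))
    tight-count-impossible (inj₂ (m%6≡5 , x∈))      ∑size≡ G+D≡ = ∑defect+missingPairs≢2 x∈ ∑size≡ (trans G+D≡ (m*[m∸1]%6 m 4 m%6≡5))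

lemma2p5 : ∀ (m n x : ℕ) → 0 < m → 0 < n → m % 2 ≡ 1 → InS m x →
    n ≡ third-binom m ∸ x →
    ∀ (H : Hypergraph m n) → Linear H → totalDegree H ≤ bound m n
lemma2p5 m n x _ 0<n m%2≡1 x∈S n≡ H linear =
  subst (_≤ bound m n) (sym totalDegree≡∑size) (≰⇒≤∸1 not-tight)
  where
  open LinearHypergraph H linear
  q : ℕ
  q = m * (m ∸ 1) / 6

  q≡n+x : q ≡ n + x
  q≡n+x = 0<k≡m∸n⇒m≡k+n 0<n (trans n≡ (cong (_∸ x) (third-binom≡ m)))

  not-tight : ¬ (q + 2 * n ≤ ∑[ i < n ] size i)
  not-tight q+2n≤∑size =
    let ∑size≡q+2n , ∑defect+missingPairs≡ = large-∑size⇒tight q+2n≤∑size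
    in tight-count-impossible (%2≡1⇒odd m m%2≡1) x∈S
         (trans ∑size≡q+2n (trans (cong (_+ 2 * n) q≡n+x) (m+n+2*m≡m*3+n n x))) ∑defect+missingPairs≡
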